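{- Let $p$ be a prime number, $G'$ a finite group of order coprime to $p$, $H'$ a subgroup of $G'$, and $(V,\rho)$ an $H'$-extremal $\mathbb{F}_p$-representation of $G'$. Put $\overline{G}:=\rho(G')$ and $\overline{H}:=\rho(H')$. Then $(\overline{G}:\overline{H})\geq 3$ and $N^{\overline{G}}(\overline{H})=\{1\}$. In particular, $N^{G'}(H')$ acts trivially on $V$.
   Context: An $\mathbb{F}_p$-representation $(V,\rho)$ of $G'$ (finite-dimensional $V$, $\rho\colon G'\to\mathrm{GL}(V)$) is $H'$-extremal if $\dim_{\mathbb{F}_p}V=2$, $V^{G'}=\{0\}$, and there is a 1-dimensional subspace $L\subset V$ with $H'\subset\mathrm{Stab}_{G'}(L)=\mathrm{Fix}_{G'}(L)$ (stabilizer and pointwise stabilizer of $L$). $N^{G}(A):=\bigcap_{g\in G}gAg^{ -1}$ is the normal core. -}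

module Defs where

open import Level using (Level; _⊔_)
open import Data.Nat using (ℕ; NonZero; _+_; _*_)
open import Data.Nat.DivMod using (_%_; m%n<n)
open import Data.Fin using (Fin; toℕ; fromℕ<)
open import Data.Product using (Σ; ∃; _×_; _,_)
open import Relation.Nullary using (¬_)
open import Relation.Binary.PropositionalEquality using (_≡_)
open import Algebra.Bundles using (Group)

private variable c ℓ h : Level

module _ (p : ℕ) .{{_ : NonZero p}} where

  𝔽 : Set
  𝔽 = Fin p

  ⟦_⟧ : ℕ → 𝔽
  ⟦ m ⟧ = fromℕ< (m%n<n m p)

  _+𝔽_ : 𝔽 → 𝔽 → 𝔽
  a +𝔽 b = ⟦ toℕ a + toℕ b ⟧

  _*𝔽_ : 𝔽 → 𝔽 → 𝔽
  a *𝔽 b = ⟦ toℕ a * toℕ b ⟧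

  0𝔽 1𝔽 : 𝔽
  0𝔽 = ⟦ 0 ⟧
  1𝔽 = ⟦ 1 ⟧

  Vec2 : Set
  Vec2 = 𝔽 × 𝔽

  zeroV : Vec2
  zeroV = 0𝔽 , 0𝔽

  _•_ : 𝔽 → Vec2 → Vec2
  k • (x , y) = (k *𝔽 x) , (k *𝔽 y)

  record Mat2 : Set where
    constructor mat
    field m₁₁ m₁₂ m₂₁ m₂₂ : 𝔽

  act : Mat2 → Vec2 → Vec2
  act (mat a b c d) (x , y) = ((a *𝔽 x) +𝔽 (b *𝔽 y)) , ((c *𝔽 x) +𝔽 (d *𝔽 y))

  _·_ : Mat2 → Mat2 → Mat2
  mat a b c d · mat a' b' c' d' =
    mat ((a *𝔽 a') +𝔽 (b *𝔽 c')) ((a *𝔽 b') +𝔽 (b *𝔽 d'))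
        ((c *𝔽 a') +𝔽 (d *𝔽 c')) ((c *𝔽 b') +𝔽 (d *𝔽 d'))

  I₂ : Mat2
  I₂ = mat 1𝔽 0𝔽 0𝔽 1𝔽

  -- A group homomorphism ρ : G' → GL(V)  (invertibility of ρ g follows from ρ ε ≡ I₂).
  record Rep (G : Group c ℓ) : Set (c ⊔ ℓ) where
    open Group G
    field
      ρ     : Carrier → Mat2
      ρ-cong : ∀ {x y} → x ≈ y → ρ x ≡ ρ y
      ρ-ε   : ρ ε ≡ I₂
      ρ-∙   : ∀ x y → ρ (x ∙ y) ≡ ρ x · ρ y

  InLine : Vec2 → Vec2 → Set
  InLine w u = ∃ λ (k : 𝔽) → u ≡ k • w

  module _ {G : Group c ℓ} (R : Rep G) where
    open Group G
    open Rep R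

    InStab : Vec2 → Carrier → Set
    InStab w g = (∀ u → InLine w u → InLine w (act (ρ g) u))
               × (∀ u → InLine w u → ∃ λ u' → InLine w u' × act (ρ g) u' ≡ u)

    InFix : Vec2 → Carrier → Set
    InFix w g = ∀ u → InLine w u → act (ρ g) u ≡ u

    -- (V, ρ) is H'-extremal (dim V = 2 is built into V = 𝔽_p²).
    IsExtremal : (Carrier → Set h) → Set (c ⊔ h)
    IsExtremal H =
        (∀ v → (∀ g → act (ρ g) v ≡ v) → v ≡ zeroV)
      × (∃ λ (w : Vec2) → ¬ (w ≡ zeroV)
          × (∀ g → H g → InStab w g)
          × (∀ g → (InStab w g → InFix w g) × (InFix w g → InStab w g)))

    InGbar : Mat2 → Set c
    InGbar m = ∃ λ g → ρ g ≡ m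

    InHbar : (Carrier → Set h) → Mat2 → Set (c ⊔ h)
    InHbar H m = ∃ λ g → H g × ρ g ≡ m

    SameCoset : (Carrier → Set h) → Mat2 → Mat2 → Set (c ⊔ h)
    SameCoset H x y = ∀ m → ((∃ λ k → InHbar H k × m ≡ x · k) → (∃ λ k → InHbar H k × m ≡ y · k))
                          × ((∃ λ k → InHbar H k × m ≡ y · k) → (∃ λ k → InHbar H k × m ≡ x · k))

    IndexAtLeast3 : (Carrier → Set h) → Set (c ⊔ h)
    IndexAtLeast3 H = ∃ λ x → ∃ λ y → ∃ λ z →
        InGbar x × InGbar y × InGbar z
      × ¬ SameCoset H x y × ¬ SameCoset H x z × ¬ SameCoset H y z

    -- N^{Ḡ}(H̄) = {1}: every x ∈ Ḡ lying in g H̄ g⁻¹ for all g ∈ Ḡ is the identity.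
    -- (For g = ρ b ∈ Ḡ, its inverse in Ḡ is ρ (b ⁻¹).)
    CoreBarTrivial : (Carrier → Set h) → Set (c ⊔ h)
    CoreBarTrivial H = ∀ x → InGbar x →
        (∀ b → ∃ λ k → InHbar H k × x ≡ (ρ b · k) · ρ (b ⁻¹)) → x ≡ I₂

record IsSubgroup (G : Group c ℓ) (H : Group.Carrier G → Set h) : Set (c ⊔ ℓ ⊔ h) where
  open Group G
  field
    resp  : ∀ {x y} → x ≈ y → H x → H y
    ε∈    : H ε
    ∙∈    : ∀ {x y} → H x → H y → H (x ∙ y)
    ⁻¹∈   : ∀ {x} → H x → H (x ⁻¹)

-- a ∈ N^{G}(H) = ⋂_{b ∈ G} b H b⁻¹
InCore : (G : Group c ℓ) → (Group.Carrier G → Set h) → Group.Carrier G → Set (c ⊔ ℓ ⊔ h)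
InCore G H a = ∀ b → ∃ λ k → H k × a ≈ (b ∙ k) ∙ (b ⁻¹)
  where open Group G

-- Let w span L; every element of H' fixes w. As V has no nonzero fixed vector, some b₀ moves
-- w off L (otherwise every element would stabilise, hence fix, L), so w and v = ρ(b₀) w are
-- independent. An element of the core of H̄ lies in ρ(b) H̄ ρ(b)⁻¹ for every b, so it fixes
-- every ρ(b) w, in particular w and v, and is the identity. A coset x H̄ determines x w, and
-- the orbit of w does not lie in {w, v}: otherwise every ρ(g) would permute {w, v} and fix
-- w + v ≠ 0. Hence 1, ρ(b₀) and any ρ(g) with ρ(g) w ∉ {w, v} lie in three distinct cosets.
{-# OPTIONS --safe #-}
module Submission where

open import Defs
open import Level using (Level; 0ℓ; _⊔_)
open import Data.Nat as ℕ using (ℕ; NonZero)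
import Data.Nat.Properties as ℕ
open import Data.Nat.DivMod
  using (_%_; m%n<n; %-distribˡ-+; %-distribˡ-*; n%n≡0; m*n%n≡0; m<n⇒m%n≡m; [m+kn]%n≡m%n)
open import Data.Nat.Primality using (Prime)
open import Data.Nat.Coprimality using (Coprime; prime⇒coprime; coprime-Bézout)
open import Data.Nat.GCD using (module Bézout)
open import Data.Fin using (Fin; toℕ; _≟_)
open import Data.Fin.Properties
  using (toℕ-fromℕ<; fromℕ<-cong; toℕ-injective; toℕ<n; any?; all?; ¬∀⟶∃¬)
open import Data.Product using (_×_; ∃; _,_; proj₁; proj₂)
open import Data.Product.Properties using (≡-dec)
open import Data.Sum using (_⊎_; inj₁; inj₂)
open import Function using (_∘_)
open import Function.Bundles using (Inverse)
open import Relation.Nullary using (¬_; yes; no; contradiction)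
open import Relation.Nullary.Decidable using (_⊎-dec_)
open import Relation.Unary using (Decidable)
open import Relation.Binary using (Setoid; DecidableEquality)
open import Relation.Binary.Definitions using (_Respects_)
open import Relation.Binary.PropositionalEquality hiding ([_])
open import Algebra.Bundles using (Group; CommutativeRing)
open import Algebra.Consequences.Propositional using (comm∧idˡ⇒id; comm∧invˡ⇒inv; comm∧distrˡ⇒distrʳ)

module PrimeField (p : ℕ) .{{_ : NonZero p}} where

  open ≡-Reasoning

  infix  8 -_
  infixl 7 _*_
  infixl 6 _+_

  [_] : ℕ → 𝔽 p
  [ m ] = ⟦_⟧ p m

  _+_ _*_ : 𝔽 p → 𝔽 p → 𝔽 p
  _+_ = _+𝔽_ p
  _*_ = _*𝔽_ p

  -_ : 𝔽 p → 𝔽 p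
  - x = [ p ℕ.∸ toℕ x ]

  0# 1# : 𝔽 p
  0# = 0𝔽 p
  1# = 1𝔽 p

  toℕ-[] : ∀ m → toℕ [ m ] ≡ m % p
  toℕ-[] m = toℕ-fromℕ< (m%n<n m p)

  []-cong-% : ∀ {m n} → m % p ≡ n % p → [ m ] ≡ [ n ]
  []-cong-% {m} {n} eq = fromℕ<-cong _ _ eq (m%n<n m p) (m%n<n n p)

  []≡0# : ∀ {m} → m % p ≡ 0 → [ m ] ≡ 0#
  []≡0# m%p≡0 = []-cong-% (trans m%p≡0 (sym (m*n%n≡0 0 p)))

  [toℕ] : ∀ x → [ toℕ x ] ≡ x
  [toℕ] x = toℕ-injective (trans (toℕ-[] (toℕ x)) (m<n⇒m%n≡m (toℕ<n x)))

  []-elim : {P : 𝔽 p → Set} → (∀ m → P [ m ]) → ∀ x → P x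
  []-elim {P} P[] x = subst P ([toℕ] x) (P[] (toℕ x))

  []-+ : ∀ m n → [ m ] + [ n ] ≡ [ m ℕ.+ n ]
  []-+ m n = []-cong-% (begin
    (toℕ [ m ] ℕ.+ toℕ [ n ]) % p   ≡⟨ cong₂ (λ a b → (a ℕ.+ b) % p) (toℕ-[] m) (toℕ-[] n) ⟩
    (m % p ℕ.+ n % p) % p           ≡⟨ %-distribˡ-+ m n p ⟨
    (m ℕ.+ n) % p                   ∎)

  []-* : ∀ m n → [ m ] * [ n ] ≡ [ m ℕ.* n ]
  []-* m n = []-cong-% (begin
    (toℕ [ m ] ℕ.* toℕ [ n ]) % p   ≡⟨ cong₂ (λ a b → (a ℕ.* b) % p) (toℕ-[] m) (toℕ-[] n) ⟩
    (m % p ℕ.* (n % p)) % p         ≡⟨ %-distribˡ-* m n p ⟨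
    (m ℕ.* n) % p                   ∎)

  +-comm : ∀ x y → x + y ≡ y + x
  +-comm x y = cong [_] (ℕ.+-comm (toℕ x) (toℕ y))

  *-comm : ∀ x y → x * y ≡ y * x
  *-comm x y = cong [_] (ℕ.*-comm (toℕ x) (toℕ y))

  +-assoc : ∀ x y z → x + y + z ≡ x + (y + z)
  +-assoc = []-elim λ a → []-elim λ b → []-elim λ c → begin
    [ a ] + [ b ] + [ c ]      ≡⟨ cong (_+ [ c ]) ([]-+ a b) ⟩
    [ a ℕ.+ b ] + [ c ]        ≡⟨ []-+ (a ℕ.+ b) c ⟩
    [ a ℕ.+ b ℕ.+ c ]          ≡⟨ cong [_] (ℕ.+-assoc a b c) ⟩
    [ a ℕ.+ (b ℕ.+ c) ]        ≡⟨ []-+ a (b ℕ.+ c) ⟨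
    [ a ] + [ b ℕ.+ c ]        ≡⟨ cong ([ a ] +_) ([]-+ b c) ⟨
    [ a ] + ([ b ] + [ c ])    ∎

  *-assoc : ∀ x y z → x * y * z ≡ x * (y * z)
  *-assoc = []-elim λ a → []-elim λ b → []-elim λ c → begin
    [ a ] * [ b ] * [ c ]      ≡⟨ cong (_* [ c ]) ([]-* a b) ⟩
    [ a ℕ.* b ] * [ c ]        ≡⟨ []-* (a ℕ.* b) c ⟩
    [ a ℕ.* b ℕ.* c ]          ≡⟨ cong [_] (ℕ.*-assoc a b c) ⟩
    [ a ℕ.* (b ℕ.* c) ]        ≡⟨ []-* a (b ℕ.* c) ⟨
    [ a ] * [ b ℕ.* c ]        ≡⟨ cong ([ a ] *_) ([]-* b c) ⟨
    [ a ] * ([ b ] * [ c ])    ∎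

  *-distribˡ-+ : ∀ x y z → x * (y + z) ≡ x * y + x * z
  *-distribˡ-+ = []-elim λ a → []-elim λ b → []-elim λ c → begin
    [ a ] * ([ b ] + [ c ])          ≡⟨ cong ([ a ] *_) ([]-+ b c) ⟩
    [ a ] * [ b ℕ.+ c ]              ≡⟨ []-* a (b ℕ.+ c) ⟩
    [ a ℕ.* (b ℕ.+ c) ]              ≡⟨ cong [_] (ℕ.*-distribˡ-+ a b c) ⟩
    [ a ℕ.* b ℕ.+ a ℕ.* c ]          ≡⟨ []-+ (a ℕ.* b) (a ℕ.* c) ⟨
    [ a ℕ.* b ] + [ a ℕ.* c ]        ≡⟨ cong₂ _+_ ([]-* a b) ([]-* a c) ⟨
    [ a ] * [ b ] + [ a ] * [ c ]    ∎

  +-identityˡ : ∀ x → 0# + x ≡ x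
  +-identityˡ = []-elim λ a → []-+ 0 a

  *-identityˡ : ∀ x → 1# * x ≡ x
  *-identityˡ = []-elim λ a → trans ([]-* 1 a) (cong [_] (ℕ.*-identityˡ a))

  -‿inverseˡ : ∀ x → - x + x ≡ 0#
  -‿inverseˡ x = begin
    - x + x                         ≡⟨ cong (- x +_) ([toℕ] x) ⟨
    [ p ℕ.∸ toℕ x ] + [ toℕ x ]     ≡⟨ []-+ (p ℕ.∸ toℕ x) (toℕ x) ⟩
    [ p ℕ.∸ toℕ x ℕ.+ toℕ x ]       ≡⟨ cong [_] (ℕ.m∸n+n≡m (ℕ.<⇒≤ (toℕ<n x))) ⟩
    [ p ]                           ≡⟨ []≡0# (n%n≡0 p) ⟩
    0#                              ∎

  toℕ-≢0 : ∀ {x} → x ≢ 0# → toℕ x ≢ 0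
  toℕ-≢0 x≢0 toℕx≡0 = x≢0 (toℕ-injective (trans toℕx≡0 (sym (trans (toℕ-[] 0) (m*n%n≡0 0 p)))))

  []*-toℕ : ∀ m x → [ m ] * x ≡ [ m ℕ.* toℕ x ]
  []*-toℕ m x = trans (cong ([ m ] *_) (sym ([toℕ] x))) ([]-* m (toℕ x))

  commutativeRing : CommutativeRing 0ℓ 0ℓ
  commutativeRing = record
    { Carrier = 𝔽 p ; _≈_ = _≡_ ; _+_ = _+_ ; _*_ = _*_ ; -_ = -_ ; 0# = 0# ; 1# = 1#
    ; isCommutativeRing = record
      { isRing = record
        { +-isAbelianGroup = record
          { isGroup = record
            { isMonoid = record
              { isSemigroup = record
                { isMagma = record { isEquivalence = isEquivalence ; ∙-cong = cong₂ _+_ }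
                ; assoc = +-assoc }
              ; identity = comm∧idˡ⇒id +-comm +-identityˡ }
            ; inverse = comm∧invˡ⇒inv +-comm -‿inverseˡ
            ; ⁻¹-cong = cong -_ }
          ; comm = +-comm }
        ; *-cong = cong₂ _*_
        ; *-assoc = *-assoc
        ; *-identity = comm∧idˡ⇒id *-comm *-identityˡ
        ; distrib = *-distribˡ-+ , comm∧distrˡ⇒distrʳ *-comm *-distribˡ-+ }
      ; *-comm = *-comm } }

  open CommutativeRing commutativeRing public
    using ( +-identityʳ; *-identityʳ; zeroˡ; zeroʳ
          ; ring; commutativeSemiring; +-commutativeSemigroup; *-commutativeSemigroup)
  open import Algebra.Properties.Ring ring public
    using (+-cancelʳ; +-inverseʳ-unique; -‿distribˡ-*; -1*x≈-x; x∙y⁻¹≈ε⇒x≈y)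
  open import Algebra.Properties.CommutativeSemigroup +-commutativeSemigroup public
    using () renaming (interchange to +-interchange)
  open import Algebra.Properties.CommutativeSemigroup *-commutativeSemigroup public
    using () renaming (x∙yz≈y∙xz to *-left-comm; x∙yz≈zx∙y to *-rotate)
  open import Algebra.Solver.Ring.NaturalCoefficients.Default commutativeSemiring
    using (solve; _:=_; _:+_; _:*_)
  open import Algebra.Definitions {A = 𝔽 p} _≡_ using (AlmostLeftCancellative)

  module _ (p-prime : Prime p) where

    -- Bézout for the coprime pair (p, toℕ x): Y · toℕ x is ≡ 1 or ≡ −1 modulo p.
    inverse : ∀ x → x ≢ 0# → ∃ λ y → y * x ≡ 1#
    inverse x x≢0 with coprime-Bézout (prime⇒coprime p-prime {{ℕ.≢-nonZero (toℕ-≢0 x≢0)}} (toℕ<n x))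
    ... | Bézout.-+ X Y 1+Xp≡Ya = [ Y ] , (begin
      [ Y ] * x                 ≡⟨ []*-toℕ Y x ⟩
      [ Y ℕ.* toℕ x ]           ≡⟨ cong [_] 1+Xp≡Ya ⟨
      [ 1 ℕ.+ X ℕ.* p ]         ≡⟨ []-cong-% ([m+kn]%n≡m%n 1 X p) ⟩
      1#                        ∎)
    ... | Bézout.+- X Y 1+Ya≡Xp = - [ Y ] , (begin
      - [ Y ] * x               ≡⟨ -‿distribˡ-* [ Y ] x ⟨
      - ([ Y ] * x)             ≡⟨ cong -_ ([]*-toℕ Y x) ⟩
      - [ Y ℕ.* toℕ x ]         ≡⟨ +-inverseʳ-unique [ Y ℕ.* toℕ x ] 1# Ya+1≡0 ⟨
      1#                        ∎)
      where
      Ya+1≡0 : [ Y ℕ.* toℕ x ] + 1# ≡ 0#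
      Ya+1≡0 = begin
        [ Y ℕ.* toℕ x ] + [ 1 ]   ≡⟨ []-+ (Y ℕ.* toℕ x) 1 ⟩
        [ Y ℕ.* toℕ x ℕ.+ 1 ]     ≡⟨ cong [_] (trans (ℕ.+-comm (Y ℕ.* toℕ x) 1) 1+Ya≡Xp) ⟩
        [ X ℕ.* p ]               ≡⟨ []≡0# (m*n%n≡0 X p) ⟩
        0#                        ∎

    *-cancelˡ-nonZero : AlmostLeftCancellative 0# _*_
    *-cancelˡ-nonZero x y z x≢0 xy≡xz = begin
      y             ≡⟨ *-identityˡ y ⟨
      1# * y        ≡⟨ cong (_* y) i*x≡1 ⟨
      i * x * y     ≡⟨ *-assoc i x y ⟩
      i * (x * y)   ≡⟨ cong (i *_) xy≡xz ⟩
      i * (x * z)   ≡⟨ *-assoc i x z ⟨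
      i * x * z     ≡⟨ cong (_* z) i*x≡1 ⟩
      1# * z        ≡⟨ *-identityˡ z ⟩
      z             ∎
      where
      i = proj₁ (inverse x x≢0)
      i*x≡1 = proj₂ (inverse x x≢0)

    -- (x − y) a and (x − y) b are the two sides of the hypothesis shifted by y a + y b.
    -- The solver works over the commutative semiring, so − y enters as an atom n with n + y ≡ 0#.
    ax+by≡ay+bx⇒a≡b : ∀ {x y a b} → x ≢ y → a * x + b * y ≡ a * y + b * x → a ≡ b
    ax+by≡ay+bx⇒a≡b {x} {y} {a} {b} x≢y ax+by≡ay+bx =
      *-cancelˡ-nonZero (x + - y) a b (x≢y ∘ x∙y⁻¹≈ε⇒x≈y x y) (+-cancelʳ (y * a + y * b) _ _ (begin
        (x + - y) * a + (y * a + y * b)   ≡⟨ regroupˡ x y (- y) a b ⟩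
        (a * x + b * y) + (- y + y) * a   ≡⟨ cong₂ _+_ ax+by≡ay+bx (trans (annihilates a) (sym (annihilates b))) ⟩
        (a * y + b * x) + (- y + y) * b   ≡⟨ regroupʳ x y (- y) a b ⟩
        (x + - y) * b + (y * a + y * b)   ∎))
      where
      annihilates : ∀ z → (- y + y) * z ≡ 0#
      annihilates z = trans (cong (_* z) (-‿inverseˡ y)) (zeroˡ z)
      regroupˡ : ∀ x y n a b → (x + n) * a + (y * a + y * b) ≡ (a * x + b * y) + (n + y) * a
      regroupˡ = solve 5 (λ x y n a b →
        (x :+ n) :* a :+ (y :* a :+ y :* b) := (a :* x :+ b :* y) :+ (n :+ y) :* a) refl
      regroupʳ : ∀ x y n a b → (a * y + b * x) + (n + y) * b ≡ (x + n) * b + (y * a + y * b)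
      regroupʳ = solve 5 (λ x y n a b →
        (a :* y :+ b :* x) :+ (n :+ y) :* b := (x :+ n) :* b :+ (y :* a :+ y :* b)) refl

    affine-injective : ∀ {x y a a' c d}
                     → x ≢ y → a * x + c ≡ a * y + d → a' * x + c ≡ a' * y + d → a ≡ a'
    affine-injective {x} {y} {a} {a'} {c} {d} x≢y e e' =
      ax+by≡ay+bx⇒a≡b x≢y (+-cancelʳ (c + d) _ _ (begin
        (a * x + a' * y) + (c + d)   ≡⟨ +-interchange (a * x) (a' * y) c d ⟩
        (a * x + c) + (a' * y + d)   ≡⟨ cong₂ _+_ e (sym e') ⟩
        (a * y + d) + (a' * x + c)   ≡⟨ +-interchange (a * y) d (a' * x) c ⟩
        (a * y + a' * x) + (d + c)   ≡⟨ cong (a * y + a' * x +_) (+-comm d c) ⟩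
        (a * y + a' * x) + (c + d)   ∎))

    proportional : ∀ {a b c d} → a ≢ 0# → a * d ≡ b * c → ∃ λ k → c ≡ k * a × d ≡ k * b
    proportional {a} {b} {c} {d} a≢0 ad≡bc = c * i , c≡cia , d≡cib
      where
      i = proj₁ (inverse a a≢0)
      i*a≡1 = proj₂ (inverse a a≢0)
      c≡cia : c ≡ c * i * a
      c≡cia = begin
        c             ≡⟨ *-identityʳ c ⟨
        c * 1#        ≡⟨ cong (c *_) i*a≡1 ⟨
        c * (i * a)   ≡⟨ *-assoc c i a ⟨
        c * i * a     ∎
      d≡cib : d ≡ c * i * b
      d≡cib = begin
        d             ≡⟨ *-identityˡ d ⟨
        1# * d        ≡⟨ cong (_* d) i*a≡1 ⟨
        i * a * d     ≡⟨ *-assoc i a d ⟩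
        i * (a * d)   ≡⟨ cong (i *_) ad≡bc ⟩
        i * (b * c)   ≡⟨ *-rotate i b c ⟩
        c * i * b     ∎

module Plane (p : ℕ) .{{_ : NonZero p}} where

  open PrimeField p
  open import Algebra.Solver.Ring.NaturalCoefficients.Default commutativeSemiring
    using (solve; _:=_; _:+_; _:*_)
  open ≡-Reasoning

  infixl 6 _+ᵥ_
  infixr 7 _•ᵥ_
  infixl 7 _⊙_
  infix  4 _≟ᵥ_

  _+ᵥ_ : Vec2 p → Vec2 p → Vec2 p
  (x₁ , x₂) +ᵥ (y₁ , y₂) = x₁ + y₁ , x₂ + y₂

  _•ᵥ_ : 𝔽 p → Vec2 p → Vec2 p
  _•ᵥ_ = _•_ p

  _⊙_ : Mat2 p → Mat2 p → Mat2 p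
  _⊙_ = _·_ p

  Parallel : Vec2 p → Vec2 p → Set
  Parallel (w₁ , w₂) (v₁ , v₂) = w₁ * v₂ ≡ w₂ * v₁

  _≟ᵥ_ : DecidableEquality (Vec2 p)
  _≟ᵥ_ = ≡-dec _≟_ _≟_

  mat-cong : ∀ {a b c d a' b' c' d'}
           → a ≡ a' → b ≡ b' → c ≡ c' → d ≡ d' → mat a b c d ≡ mat a' b' c' d'
  mat-cong refl refl refl refl = refl

  act-⊙ : ∀ A B u → act p (A ⊙ B) u ≡ act p A (act p B u)
  act-⊙ (mat a b c d) (mat a' b' c' d') (x , y) = cong₂ _,_ (row a b a' b' c' d' x y) (row c d a' b' c' d' x y)
    where
    row : ∀ α β a' b' c' d' x y
        → (α * a' + β * c') * x + (α * b' + β * d') * y ≡ α * (a' * x + b' * y) + β * (c' * x + d' * y)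
    row = solve 8 (λ α β a' b' c' d' x y →
      (α :* a' :+ β :* c') :* x :+ (α :* b' :+ β :* d') :* y
        := α :* (a' :* x :+ b' :* y) :+ β :* (c' :* x :+ d' :* y)) refl

  act-I₂ : ∀ u → act p (I₂ p) u ≡ u
  act-I₂ (x , y) = cong₂ _,_
    (trans (cong₂ _+_ (*-identityˡ x) (zeroˡ y)) (+-identityʳ x))
    (trans (cong₂ _+_ (zeroˡ x) (*-identityˡ y)) (+-identityˡ y))

  ⊙-identityʳ : ∀ A → A ⊙ I₂ p ≡ A
  ⊙-identityʳ (mat a b c d) = mat-cong (first a b) (second a b) (first c d) (second c d)
    where
    first : ∀ α β → α * 1# + β * 0# ≡ α
    first α β = trans (cong₂ _+_ (*-identityʳ α) (zeroʳ β)) (+-identityʳ α)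
    second : ∀ α β → α * 0# + β * 1# ≡ β
    second α β = trans (cong₂ _+_ (zeroʳ α) (*-identityʳ β)) (+-identityˡ β)

  act-+ᵥ : ∀ A u v → act p A (u +ᵥ v) ≡ act p A u +ᵥ act p A v
  act-+ᵥ (mat a b c d) (x , y) (x' , y') = cong₂ _,_ (row a b) (row c d)
    where
    row : ∀ α β → α * (x + x') + β * (y + y') ≡ (α * x + β * y) + (α * x' + β * y')
    row α β = trans (cong₂ _+_ (*-distribˡ-+ α x x') (*-distribˡ-+ β y y'))
                    (+-interchange (α * x) (α * x') (β * y) (β * y'))

  act-•ᵥ : ∀ A k u → act p A (k •ᵥ u) ≡ k •ᵥ act p A u
  act-•ᵥ (mat a b c d) k (x , y) = cong₂ _,_ (row a b) (row c d)
    where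
    row : ∀ α β → α * (k * x) + β * (k * y) ≡ k * (α * x + β * y)
    row α β = trans (cong₂ _+_ (*-left-comm α k x) (*-left-comm β k y)) (sym (*-distribˡ-+ k (α * x) (β * y)))

  •ᵥ-assoc : ∀ k l u → k •ᵥ l •ᵥ u ≡ (k * l) •ᵥ u
  •ᵥ-assoc k l (x , y) = cong₂ _,_ (sym (*-assoc k l x)) (sym (*-assoc k l y))

  •ᵥ-identityˡ : ∀ u → 1# •ᵥ u ≡ u
  •ᵥ-identityˡ (x , y) = cong₂ _,_ (*-identityˡ x) (*-identityˡ y)

  +ᵥ-comm : ∀ u v → u +ᵥ v ≡ v +ᵥ u
  +ᵥ-comm (x , y) (x' , y') = cong₂ _,_ (+-comm x x') (+-comm y y')

  InLine-refl : ∀ w → InLine p w w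
  InLine-refl w = 1# , sym (•ᵥ-identityˡ w)

  InLine? : ∀ w → Decidable (InLine p w)
  InLine? w u = any? λ k → u ≟ᵥ k •ᵥ w

  InLine-act : ∀ A {w u} → InLine p w (act p A w) → InLine p w u → InLine p w (act p A u)
  InLine-act A {w} (k , Aw≡kw) (l , refl) = l * k , (begin
    act p A (l •ᵥ w)   ≡⟨ act-•ᵥ A l w ⟩
    l •ᵥ act p A w     ≡⟨ cong (l •ᵥ_) Aw≡kw ⟩
    l •ᵥ k •ᵥ w        ≡⟨ •ᵥ-assoc l k w ⟩
    (l * k) •ᵥ w       ∎)

  +ᵥ≡0⇒InLine : ∀ {u v} → u +ᵥ v ≡ zeroV p → InLine p u v
  +ᵥ≡0⇒InLine {u₁ , u₂} eq = - 1# , cong₂ _,_ (negation (cong proj₁ eq)) (negation (cong proj₂ eq))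
    where
    negation : ∀ {x y} → x + y ≡ 0# → y ≡ - 1# * x
    negation {x} {y} x+y≡0 = trans (+-inverseʳ-unique x y x+y≡0) (sym (-1*x≈-x x))

  pair-sum : ∀ {a b w v : Vec2 p} → a ≢ b → a ≡ w ⊎ a ≡ v → b ≡ w ⊎ b ≡ v → a +ᵥ b ≡ w +ᵥ v
  pair-sum a≢b (inj₁ refl) (inj₁ refl) = contradiction refl a≢b
  pair-sum a≢b (inj₁ refl) (inj₂ refl) = refl
  pair-sum {w = w} {v} a≢b (inj₂ refl) (inj₁ refl) = +ᵥ-comm v w
  pair-sum a≢b (inj₂ refl) (inj₂ refl) = contradiction refl a≢b

  -- Cramer's rule for the row (α β) with both sides moved so that no subtraction occurs:
  -- α · det(w, v) = v₂ (α w₁ + β w₂) − w₂ (α v₁ + β v₂), and similarly for β.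
  cramerˡ : ∀ α β w₁ w₂ v₁ v₂
          → α * (w₁ * v₂) + w₂ * (α * v₁ + β * v₂) ≡ α * (w₂ * v₁) + v₂ * (α * w₁ + β * w₂)
  cramerˡ = solve 6 (λ α β w₁ w₂ v₁ v₂ →
    α :* (w₁ :* v₂) :+ w₂ :* (α :* v₁ :+ β :* v₂)
      := α :* (w₂ :* v₁) :+ v₂ :* (α :* w₁ :+ β :* w₂)) refl

  cramerʳ : ∀ α β w₁ w₂ v₁ v₂
          → β * (w₁ * v₂) + v₁ * (α * w₁ + β * w₂) ≡ β * (w₂ * v₁) + w₁ * (α * v₁ + β * v₂)
  cramerʳ = solve 6 (λ α β w₁ w₂ v₁ v₂ →
    β :* (w₁ :* v₂) :+ v₁ :* (α :* w₁ :+ β :* w₂)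
      := β :* (w₂ :* v₁) :+ w₁ :* (α :* v₁ :+ β :* v₂)) refl

  module _ (p-prime : Prime p) where

    parallel⇒InLine : ∀ {w v} → w ≢ zeroV p → Parallel w v → InLine p w v
    parallel⇒InLine {w₁ , w₂} {v₁ , v₂} w≢0 w∥v with w₁ ≟ 0# | w₂ ≟ 0#
    ... | no w₁≢0 | _ =
      let (k , v₁≡kw₁ , v₂≡kw₂) = proportional p-prime w₁≢0 w∥v in k , cong₂ _,_ v₁≡kw₁ v₂≡kw₂
    ... | yes _ | no w₂≢0 =
      let (k , v₂≡kw₂ , v₁≡kw₁) = proportional p-prime w₂≢0 (sym w∥v) in k , cong₂ _,_ v₁≡kw₁ v₂≡kw₂
    ... | yes w₁≡0 | yes w₂≡0 = contradiction (cong₂ _,_ w₁≡0 w₂≡0) w≢0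

    row-unique : ∀ {α β α' β'} w v → ¬ Parallel w v
               → α * proj₁ w + β * proj₂ w ≡ α' * proj₁ w + β' * proj₂ w
               → α * proj₁ v + β * proj₂ v ≡ α' * proj₁ v + β' * proj₂ v
               → α ≡ α' × β ≡ β'
    row-unique {α} {β} {α'} {β'} (w₁ , w₂) (v₁ , v₂) w∦v on-w on-v =
        affine-injective p-prime w∦v
          (subst₂ (λ s t → α * (w₁ * v₂) + w₂ * t ≡ α * (w₂ * v₁) + v₂ * s) on-w on-v
                  (cramerˡ α β w₁ w₂ v₁ v₂))
          (cramerˡ α' β' w₁ w₂ v₁ v₂)
      , affine-injective p-prime w∦v
          (subst₂ (λ s t → β * (w₁ * v₂) + v₁ * s ≡ β * (w₂ * v₁) + w₁ * t) on-w on-v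
                  (cramerʳ α β w₁ w₂ v₁ v₂))
          (cramerʳ α' β' w₁ w₂ v₁ v₂)

    act≡⇒≡ : ∀ {w v} A B → ¬ Parallel w v → act p A w ≡ act p B w → act p A v ≡ act p B v → A ≡ B
    act≡⇒≡ {w} {v} (mat a b c d) (mat a' b' c' d') w∦v Aw≡Bw Av≡Bv =
      let (a≡a' , b≡b') = row-unique w v w∦v (cong proj₁ Aw≡Bw) (cong proj₁ Av≡Bv)
          (c≡c' , d≡d') = row-unique w v w∦v (cong proj₂ Aw≡Bw) (cong proj₂ Av≡Bv)
      in mat-cong a≡a' b≡b' c≡c' d≡d'

    fixes-independent⇒I₂ : ∀ {w v} A → ¬ Parallel w v → act p A w ≡ w → act p A v ≡ v → A ≡ I₂ p
    fixes-independent⇒I₂ {w} {v} A w∦v Aw≡w Av≡v =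
      act≡⇒≡ A (I₂ p) w∦v (trans Aw≡w (sym (act-I₂ w))) (trans Av≡v (sym (act-I₂ v)))

module FiniteSearch {a ℓ} {S : Setoid a ℓ} {n : ℕ} (enum : Inverse (setoid (Fin n)) S) where

  open Setoid S using (Carrier; _≈_)
  open Inverse enum using (to; from; strictlyInverseˡ)

  ∀⊎∃¬ : ∀ {q} {P : Carrier → Set q} → Decidable P → P Respects _≈_ → (∀ x → P x) ⊎ ∃ λ x → ¬ P x
  ∀⊎∃¬ P? resp with all? (P? ∘ to)
  ... | yes ∀P = inj₁ λ x → resp (strictlyInverseˡ x) (∀P (from x))
  ... | no ¬∀P = let (i , ¬Pi) = ¬∀⟶∃¬ n _ (P? ∘ to) ¬∀P in inj₂ (to i , ¬Pi)

module Orbits {c ℓ} {G : Group c ℓ} {p : ℕ} .{{_ : NonZero p}} (R : Rep p G) where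

  open Group G using (Carrier; _≈_; _∙_; ε; _⁻¹; inverseˡ; inverseʳ)
  open Rep R
  open Plane p using (act-⊙; act-I₂)
  open ≡-Reasoning

  infixr 5 _▸_

  _▸_ : Carrier → Vec2 p → Vec2 p
  g ▸ u = act p (ρ g) u

  ▸-cong : ∀ {g h} u → g ≈ h → g ▸ u ≡ h ▸ u
  ▸-cong u g≈h = cong (λ M → act p M u) (ρ-cong g≈h)

  ε▸ : ∀ u → ε ▸ u ≡ u
  ε▸ u = trans (cong (λ M → act p M u) ρ-ε) (act-I₂ u)

  ∙▸ : ∀ g h u → (g ∙ h) ▸ u ≡ g ▸ h ▸ u
  ∙▸ g h u = trans (cong (λ M → act p M u) (ρ-∙ g h)) (act-⊙ (ρ g) (ρ h) u)

  ⁻¹▸▸ : ∀ g u → g ⁻¹ ▸ g ▸ u ≡ u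
  ⁻¹▸▸ g u = begin
    g ⁻¹ ▸ g ▸ u      ≡⟨ ∙▸ (g ⁻¹) g u ⟨
    (g ⁻¹ ∙ g) ▸ u    ≡⟨ ▸-cong u (inverseˡ g) ⟩
    ε ▸ u             ≡⟨ ε▸ u ⟩
    u                 ∎

  ▸⁻¹▸ : ∀ g u → g ▸ g ⁻¹ ▸ u ≡ u
  ▸⁻¹▸ g u = begin
    g ▸ g ⁻¹ ▸ u      ≡⟨ ∙▸ g (g ⁻¹) u ⟨
    (g ∙ g ⁻¹) ▸ u    ≡⟨ ▸-cong u (inverseʳ g) ⟩
    ε ▸ u             ≡⟨ ε▸ u ⟩
    u                 ∎

  ▸-injective : ∀ g {u u'} → g ▸ u ≡ g ▸ u' → u ≡ u'
  ▸-injective g {u} {u'} gu≡gu' = begin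
    u               ≡⟨ ⁻¹▸▸ g u ⟨
    g ⁻¹ ▸ g ▸ u    ≡⟨ cong (g ⁻¹ ▸_) gu≡gu' ⟩
    g ⁻¹ ▸ g ▸ u'   ≡⟨ ⁻¹▸▸ g u' ⟩
    u'              ∎

-- Finiteness of G' is used only to make the searches over G' below decidable.
module Extremal
    {c ℓ h} {p : ℕ} .{{_ : NonZero p}} (p-prime : Prime p)
    {G : Group c ℓ} {n : ℕ} (enum : Inverse (setoid (Fin n)) (Group.setoid G))
    {H : Group.Carrier G → Set h} (H-subgroup : IsSubgroup G H)
    (R : Rep p G)
    (no-fixed : ∀ u → (∀ g → act p (Rep.ρ R g) u ≡ u) → u ≡ zeroV p)
    (w : Vec2 p) (w≢0 : w ≢ zeroV p)
    (H⊆Stab : ∀ g → H g → InStab p R w g)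
    (Stab⊆Fix : ∀ g → InStab p R w g → InFix p R w g)
    where

  open Group G using (Carrier; _∙_; ε; _⁻¹)
  open IsSubgroup H-subgroup using (ε∈)
  open Rep R
  open Plane p
  open Orbits R
  open FiniteSearch enum
  open ≡-Reasoning

  H-fixes-w : ∀ {g} → H g → g ▸ w ≡ w
  H-fixes-w {g} g∈H = Stab⊆Fix g (H⊆Stab g g∈H) w (InLine-refl w)

  some-element-moves-L : ∃ λ b → ¬ InLine p w (b ▸ w)
  some-element-moves-L
    with ∀⊎∃¬ (λ g → InLine? w (g ▸ w)) (λ g≈h → subst (InLine p w) (▸-cong w g≈h))
  ... | inj₂ moves = moves
  ... | inj₁ keeps = contradiction (no-fixed w λ g → Stab⊆Fix g (stabilises g) w (InLine-refl w)) w≢0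
    where
    stabilises : ∀ g → InStab p R w g
    stabilises g = (λ _ → InLine-act (ρ g) (keeps g))
                 , λ u u∈L → g ⁻¹ ▸ u , InLine-act (ρ (g ⁻¹)) (keeps (g ⁻¹)) u∈L , ▸⁻¹▸ g u

  b₀ : Carrier
  b₀ = proj₁ some-element-moves-L

  v : Vec2 p
  v = b₀ ▸ w

  v∉L : ¬ InLine p w v
  v∉L = proj₂ some-element-moves-L

  w∦v : ¬ Parallel w v
  w∦v = v∉L ∘ parallel⇒InLine p-prime w≢0

  v≢w : v ≢ w
  v≢w v≡w = v∉L (subst (InLine p w) (sym v≡w) (InLine-refl w))

  InCoreBar : Mat2 p → Set (c ⊔ h)
  InCoreBar x = ∀ b → ∃ λ k → InHbar p R H k × x ≡ (ρ b ⊙ k) ⊙ ρ (b ⁻¹)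

  coreBar-fixes-orbit : ∀ {x} → InCoreBar x → ∀ b → act p x (b ▸ w) ≡ b ▸ w
  coreBar-fixes-orbit x∈core b with x∈core b
  ... | _ , (h , h∈H , refl) , refl = begin
    act p (ρ b ⊙ ρ h ⊙ ρ (b ⁻¹)) (b ▸ w)   ≡⟨ act-⊙ (ρ b ⊙ ρ h) (ρ (b ⁻¹)) (b ▸ w) ⟩
    act p (ρ b ⊙ ρ h) (b ⁻¹ ▸ b ▸ w)       ≡⟨ cong (act p (ρ b ⊙ ρ h)) (⁻¹▸▸ b w) ⟩
    act p (ρ b ⊙ ρ h) w                    ≡⟨ act-⊙ (ρ b) (ρ h) w ⟩
    b ▸ h ▸ w                              ≡⟨ cong (b ▸_) (H-fixes-w h∈H) ⟩
    b ▸ w                                  ∎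

  coreBar-trivial : CoreBarTrivial p R H
  coreBar-trivial x _ x∈core = fixes-independent⇒I₂ p-prime x w∦v
    (subst (λ u → act p x u ≡ u) (ε▸ w) (coreBar-fixes-orbit x∈core ε))
    (coreBar-fixes-orbit x∈core b₀)

  sameCoset⇒same-image : ∀ x y → SameCoset p R H x y → act p y w ≡ act p x w
  sameCoset⇒same-image x y x~y with proj₂ (x~y y) (I₂ p , (ε , ε∈ , ρ-ε) , sym (⊙-identityʳ y))
  ... | _ , (h , h∈H , refl) , refl = trans (act-⊙ x (ρ h) w) (cong (act p x) (H-fixes-w h∈H))

  InPair : Vec2 p → Set
  InPair u = u ≡ w ⊎ u ≡ v

  some-element-leaves-pair : ∃ λ g → ¬ InPair (g ▸ w)
  some-element-leaves-pair
    with ∀⊎∃¬ (λ g → g ▸ w ≟ᵥ w ⊎-dec g ▸ w ≟ᵥ v) (λ g≈h → subst InPair (▸-cong w g≈h))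
  ... | inj₂ leaves = leaves
  ... | inj₁ stays = contradiction (+ᵥ≡0⇒InLine (no-fixed (w +ᵥ v) sum-fixed)) v∉L
    where
    sum-fixed : ∀ g → g ▸ (w +ᵥ v) ≡ w +ᵥ v
    sum-fixed g = trans (act-+ᵥ (ρ g) w v)
      (pair-sum (v≢w ∘ sym ∘ ▸-injective g) (stays g) (subst InPair (∙▸ g b₀ w) (stays (g ∙ b₀))))

  index≥3 : IndexAtLeast3 p R H
  index≥3 = I₂ p , ρ b₀ , ρ g , (ε , ρ-ε) , (b₀ , refl) , (g , refl)
    , (λ I~b₀ → v≢w (trans (sameCoset⇒same-image (I₂ p) (ρ b₀) I~b₀) (act-I₂ w)))
    , (λ I~g → g∉pair (inj₁ (trans (sameCoset⇒same-image (I₂ p) (ρ g) I~g) (act-I₂ w))))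
    , (λ b₀~g → g∉pair (inj₂ (sameCoset⇒same-image (ρ b₀) (ρ g) b₀~g)))
    where
    g = proj₁ some-element-leaves-pair
    g∉pair = proj₂ some-element-leaves-pair

  core⊆coreBar : ∀ {a} → InCore G H a → InCoreBar (ρ a)
  core⊆coreBar {a} a∈core b =
    let (k , k∈H , a≈bkb⁻¹) = a∈core b in
    ρ k , (k , k∈H , refl) , (begin
      ρ a                      ≡⟨ ρ-cong a≈bkb⁻¹ ⟩
      ρ (b ∙ k ∙ b ⁻¹)         ≡⟨ ρ-∙ (b ∙ k) (b ⁻¹) ⟩
      ρ (b ∙ k) ⊙ ρ (b ⁻¹)     ≡⟨ cong (_⊙ ρ (b ⁻¹)) (ρ-∙ b k) ⟩
      ρ b ⊙ ρ k ⊙ ρ (b ⁻¹)     ∎)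

  core-acts-trivially : ∀ a → InCore G H a → ∀ u → a ▸ u ≡ u
  core-acts-trivially a a∈core u =
    trans (cong (λ M → act p M u) (coreBar-trivial (ρ a) (a , refl) (core⊆coreBar a∈core))) (act-I₂ u)

proposition7p8 : ∀ {c ℓ h : Level} (p : ℕ) .{{_ : NonZero p}} → Prime p
    → (G : Group c ℓ) (n : ℕ) → Inverse (setoid (Fin n)) (Group.setoid G) → Coprime n p
    → (H : Group.Carrier G → Set h) → IsSubgroup G H
    → (R : Rep p G) → IsExtremal p R H
    → IndexAtLeast3 p R H
      × CoreBarTrivial p R H
      × (∀ a → InCore G H a → ∀ v → act p (Rep.ρ R a) v ≡ v)
proposition7p8 p p-prime G n enum _ H H-subgroup R (no-fixed , w , w≢0 , H⊆Stab , Stab⇔Fix) =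
  index≥3 , coreBar-trivial , core-acts-trivially
  where open Extremal p-prime enum H-subgroup R no-fixed w w≢0 H⊆Stab (λ g → proj₁ (Stab⇔Fix g))
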